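{- Let $d\ge1$ and $k\ge0$ be integers. The number of $d$-parking functions $(a_1,a_2,\dots,a_k)$ such that $a_i\le a_{i+1}+d-1$ for all indices $1\le i\le k-1$ is $\frac{1}{2dk-k+1}\binom{2dk}{k}$.
   Context: A $d$-parking function of length $k$ is a list $(a_1,\dots,a_k)$ of positive integers whose nondecreasing rearrangement $a_{(1)}\le\cdots\le a_{(k)}$ satisfies $a_{(i)}\le d(i-1)+1$ for all $i$. -}

module Defs where

open import Data.Nat using (ℕ; zero; suc; _+_; _*_; _∸_; _≤_; _≤?_)
open import Data.Nat.Properties using (≤-decTotalOrder)
open import Data.List using (List; []; _∷_; length; filter; map; concatMap)
open import Data.List.Relation.Unary.All using (All; all?)
open import Data.Product using (_×_; _,_)
open import Relation.Nullary using (Dec; yes; no)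
open import Relation.Nullary.Decidable using (_×-dec_)
import Data.List.Sort as Sort
open Sort ≤-decTotalOrder using (sort)

indexedFrom : ℕ → List ℕ → List (ℕ × ℕ)
indexedFrom i [] = []
indexedFrom i (x ∷ xs) = (i , x) ∷ indexedFrom (suc i) xs

IsParking : ℕ → List ℕ → Set
IsParking d as =
  All (λ x → 1 ≤ x) as ×
  All (λ p → let (i , x) = p in x ≤ d * (i ∸ 1) + 1) (indexedFrom 1 (sort as))

isParking? : ∀ d as → Dec (IsParking d as)
isParking? d as =
  all? (λ x → 1 ≤? x) as ×-dec
  all? (λ p → let (i , x) = p in x ≤? d * (i ∸ 1) + 1) (indexedFrom 1 (sort as))

data Adjacent (d : ℕ) : List ℕ → Set where
  adj-[] : Adjacent d []
  adj-[-] : ∀ x → Adjacent d (x ∷ [])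
  adj-∷ : ∀ x y ys → x ≤ y + d ∸ 1 → Adjacent d (y ∷ ys) → Adjacent d (x ∷ y ∷ ys)

adjacent? : ∀ d as → Dec (Adjacent d as)
adjacent? d [] = yes adj-[]
adjacent? d (x ∷ []) = yes (adj-[-] x)
adjacent? d (x ∷ y ∷ ys) with x ≤? y + d ∸ 1 | adjacent? d (y ∷ ys)
... | yes p | yes q = yes (adj-∷ x y ys p q)
... | no ¬p | _ = no λ { (adj-∷ _ _ _ p _) → ¬p p }
... | yes _ | no ¬q = no λ { (adj-∷ _ _ _ _ q) → ¬q q }

range1 : ℕ → List ℕ
range1 zero = []
range1 (suc B) = range1 B Data.List.++ (suc B ∷ [])

lists : ℕ → ℕ → List (List ℕ)
lists B zero = [] ∷ []
lists B (suc k) = concatMap (λ x → map (x ∷_) (lists B k)) (range1 B)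

countAdj : ℕ → ℕ → ℕ → ℕ
countAdj d k B =
  length (filter (λ as → isParking? d as ×-dec adjacent? d as) (lists B k))

-- Write d = 1 + c and m = 2d − 1. Call a positive list adjacent if aᵢ ≤ aᵢ₊₁ + c, and
-- offset-P parking if for every j below its length at least j + 1 entries are ≤ P + dj
-- (P = 1 is the d-parking condition, in counting form). Let L(k, P) count the adjacent
-- offset-P parking lists of length k. Such a list without an entry 1 is an offset-(P − 1)
-- list shifted up by one. If it contains 1, write it u ++ 1 ∷ v with all of v above 1,
-- delete that 1 and raise v by c: u ++ (c + v) is an adjacent offset-(P + m) list of length
-- k − 1, and this is a bijection. Adjacency is what makes the way back work: a walk that
-- moves down by less than d per step cannot jump over a window of d consecutive thresholds.
-- Hence L(k+1, P+1) = L(k+1, P) + L(k, P+1+m), L(k+1, 1) = L(k, 1+m) and L(0, P) = 1,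
-- which is solved by L(k, p+1) = C(n, k) − m·C(n, k−1) with n = p + 2dk. At p = 0 the
-- absorption identity k·C(n, k) = (n − k + 1)·C(n, k−1) turns this into
-- (mk + 1)·L(k, 1) = C(2dk, k).

module Submission where

open import Defs
open import Level using (Level)
open import Data.Nat using (ℕ; zero; suc; _+_; _*_; _∸_; _≤_; _<_; z≤n; s≤s; _≤?_; _<?_)
open import Data.Nat.Properties
open import Data.Nat.Combinatorics using (_C_; nC1≡n; nCk+nC[k+1]≡[n+1]C[k+1])
open import Data.Nat.Tactic.RingSolver using (solve-∀)
open import Data.List using (List; []; _∷_; _++_; length; map; filter; concatMap; applyUpTo; cartesianProductWith; last)
open import Data.List.Properties
  using (length-++; length-map; filter-++; filter-all; filter-none; filter-complete; filter-accept;
         filter-≐; length-filter; map-id-local; map-∘; map-injective; applyUpTo-∷ʳ; ∷-injective)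
open import Data.List.Relation.Unary.All as All using (All; []; _∷_; all?)
import Data.List.Relation.Unary.All.Properties as All
open import Data.List.Relation.Unary.Any as Any using (Any; here; there)
import Data.List.Relation.Unary.Any.Properties as Any
open import Data.List.Relation.Unary.Linked as Linked using (Linked; []; [-]; _∷_)
import Data.List.Relation.Unary.Linked.Properties as Linked
open import Data.List.Relation.Unary.Sorted.TotalOrder ≤-totalOrder using (Sorted)
open import Data.List.Relation.Unary.Unique.Propositional using (Unique; []; _∷_)
import Data.List.Relation.Unary.Unique.Propositional.Properties as Unique
open import Data.List.Membership.Propositional using (_∈_; _∉_)
open import Data.List.Membership.Propositional.Properties
  using (∈-++⁺ˡ; ∈-++⁺ʳ; ∈-map⁻; ∈-map⁺; ∈-filter⁻; ∈-filter⁺;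
         ∈-cartesianProductWith⁺; ∈-cartesianProductWith⁻; ∈-applyUpTo⁺)
open import Data.List.Membership.Propositional.Properties.WithK using (unique∧set⇒bag)
open import Data.List.Relation.Binary.BagAndSetEquality using (_∼[_]_; set; ∼bag⇒↭)
open import Data.List.Relation.Binary.Permutation.Propositional using (_↭_; ↭-sym)
open import Data.List.Relation.Binary.Permutation.Propositional.Properties using (↭-length; filter-↭)
open import Data.Maybe.Relation.Unary.All as Maybe using (just; nothing)
open import Data.Product using (∃₂; _×_; _,_; proj₁; proj₂)
open import Function using (_∘_; _⇔_; mk⇔; Equivalence)
open import Relation.Nullary using (¬_; Dec; yes; no; contradiction)
open import Relation.Nullary.Decidable using (_×-dec_)
open import Relation.Unary using (Pred; Decidable; _⊆_; _≐_)
open import Relation.Binary.PropositionalEquality as ≡ using (_≡_; refl; sym; trans; cong; cong₂; subst; subst₂)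
import Data.List.Sort as Sort
open Sort ≤-decTotalOrder using (sort; sort-↭; sort-↗)

private
  variable
    ℓ ℓ₁ ℓ₂ : Level
    A B D : Set ℓ

module _ {P : Pred A ℓ₁} {Q : Pred A ℓ₂} (P? : Decidable P) (Q? : Decidable Q) (P⊆Q : P ⊆ Q) where

  length-filter-mono : ∀ xs → length (filter P? xs) ≤ length (filter Q? xs)
  length-filter-mono [] = z≤n
  length-filter-mono (x ∷ xs) with P? x | Q? x
  ... | yes _  | yes _  = s≤s (length-filter-mono xs)
  ... | no _   | yes _  = m≤n⇒m≤1+n (length-filter-mono xs)
  ... | no _   | no _   = length-filter-mono xs
  ... | yes px | no ¬qx = contradiction (P⊆Q px) ¬qx

  length-filter-strictMono : ∀ {xs} → Any (λ x → Q x × ¬ P x) xs →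
                             length (filter P? xs) < length (filter Q? xs)
  length-filter-strictMono {x ∷ xs} (here (qx , ¬px)) with P? x | Q? x
  ... | yes px | _      = contradiction px ¬px
  ... | no _   | yes _  = s≤s (length-filter-mono xs)
  ... | no _   | no ¬qx = contradiction qx ¬qx
  length-filter-strictMono {x ∷ xs} (there any) with P? x | Q? x
  ... | yes _  | yes _  = s≤s (length-filter-strictMono any)
  ... | no _   | yes _  = m<n⇒m<1+n (length-filter-strictMono any)
  ... | no _   | no _   = length-filter-strictMono any
  ... | yes px | no ¬qx = contradiction (P⊆Q px) ¬qx

filter-map : {P : Pred B ℓ₁} (P? : Decidable P) (f : A → B) (xs : List A) →
             filter P? (map f xs) ≡ map f (filter (P? ∘ f) xs)
filter-map P? f [] = refl
filter-map P? f (x ∷ xs) with P? (f x)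
... | yes _ = cong (f x ∷_) (filter-map P? f xs)
... | no _  = filter-map P? f xs

unique∧set⇒length≡ : {xs ys : List A} → Unique xs → Unique ys →
                     xs ∼[ set ] ys → length xs ≡ length ys
unique∧set⇒length≡ xs! ys! xs∼ys = ↭-length (∼bag⇒↭ (unique∧set⇒bag xs! ys! xs∼ys))

++-∷-cancel : ∀ {z : A} u₁ u₂ {v₁ v₂} → z ∉ v₁ → z ∉ v₂ →
              u₁ ++ z ∷ v₁ ≡ u₂ ++ z ∷ v₂ → u₁ ≡ u₂ × v₁ ≡ v₂
++-∷-cancel []       []       _    _    refl = refl , refl
++-∷-cancel []       (y ∷ u₂) z∉v₁ _    eq with refl ← proj₂ (∷-injective eq) =
  contradiction (∈-++⁺ʳ u₂ (here refl)) z∉v₁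
++-∷-cancel (x ∷ u₁) []       _    z∉v₂ eq with refl ← proj₂ (∷-injective eq) =
  contradiction (∈-++⁺ʳ u₁ (here refl)) z∉v₂
++-∷-cancel (x ∷ u₁) (y ∷ u₂) z∉v₁ z∉v₂ eq with refl , eq′ ← ∷-injective eq =
  let u₁≡u₂ , v₁≡v₂ = ++-∷-cancel u₁ u₂ z∉v₁ z∉v₂ eq′ in cong (x ∷_) u₁≡u₂ , v₁≡v₂

concatMap-map≡cartesianProductWith : (f : A → B → D) (xs : List A) (ys : List B) →
  concatMap (λ x → map (f x) ys) xs ≡ cartesianProductWith f xs ys
concatMap-map≡cartesianProductWith f []       ys = refl
concatMap-map≡cartesianProductWith f (x ∷ xs) ys =
  cong (map (f x) ys ++_) (concatMap-map≡cartesianProductWith f xs ys)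

-- Counting entries below a threshold

count≤ : ℕ → List ℕ → ℕ
count≤ T xs = length (filter (_≤? T) xs)

module _ {T : ℕ} where

  count≤-accept : ∀ {x} xs → x ≤ T → count≤ T (x ∷ xs) ≡ suc (count≤ T xs)
  count≤-accept xs x≤T = cong length (filter-accept (_≤? T) x≤T)

  count≤-++ : ∀ xs ys → count≤ T (xs ++ ys) ≡ count≤ T xs + count≤ T ys
  count≤-++ xs ys = trans (cong length (filter-++ (_≤? T) xs ys)) (length-++ (filter (_≤? T) xs))

  count≤-↭ : ∀ {xs ys} → xs ↭ ys → count≤ T xs ≡ count≤ T ys
  count≤-↭ xs↭ys = ↭-length (filter-↭ (_≤? T) xs↭ys)

  count≤-all : ∀ {xs} → All (_≤ T) xs → count≤ T xs ≡ length xs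
  count≤-all xs≤T = cong length (filter-all (_≤? T) xs≤T)

  count≤-none : ∀ {xs} → All (T <_) xs → count≤ T xs ≡ 0
  count≤-none T<xs = cong length (filter-none (_≤? T) (All.map <⇒≱ T<xs))

  count≤-complete : ∀ {xs} → length xs ≤ count≤ T xs → All (_≤ T) xs
  count≤-complete {xs} full = subst (All (_≤ T)) (filter-complete (_≤? T) everything) (All.all-filter (_≤? T) xs)
    where
    everything : count≤ T xs ≡ length xs
    everything = ≤-antisym (length-filter (_≤? T) xs) full

count≤-mono : ∀ {T₁ T₂} → T₁ ≤ T₂ → ∀ xs → count≤ T₁ xs ≤ count≤ T₂ xs
count≤-mono {T₁} {T₂} T₁≤T₂ = length-filter-mono (_≤? T₁) (_≤? T₂) (λ x≤T₁ → ≤-trans x≤T₁ T₁≤T₂)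

count≤-strictMono : ∀ {T₁ T₂ xs} → T₁ ≤ T₂ → Any (λ w → T₁ < w × w ≤ T₂) xs →
                    count≤ T₁ xs < count≤ T₂ xs
count≤-strictMono {T₁} {T₂} T₁≤T₂ =
  length-filter-strictMono (_≤? T₁) (_≤? T₂) (λ x≤T₁ → ≤-trans x≤T₁ T₁≤T₂)
  ∘ Any.map (λ (T₁<w , w≤T₂) → w≤T₂ , <⇒≱ T₁<w)

count≤-shift : ∀ k T xs → count≤ (k + T) (map (k +_) xs) ≡ count≤ T xs
count≤-shift k T xs = begin
  length (filter (_≤? k + T) (map (k +_) xs))  ≡⟨ cong length (filter-map (_≤? k + T) (k +_) xs) ⟩
  length (map (k +_) (filter shifted? xs))     ≡⟨ length-map (k +_) (filter shifted? xs) ⟩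
  length (filter shifted? xs)                  ≡⟨ cong length (filter-≐ shifted? (_≤? T) shift-≤ xs) ⟩
  length (filter (_≤? T) xs)                   ∎
  where
  open ≡.≡-Reasoning
  shifted? : Decidable (λ x → k + x ≤ k + T)
  shifted? x = k + x ≤? k + T
  shift-≤ : (λ x → k + x ≤ k + T) ≐ (_≤ T)
  shift-≤ = +-cancelˡ-≤ k _ _ , +-monoʳ-≤ k

sorted-head≤ : ∀ {x s} → Sorted (x ∷ s) → All (x ≤_) s
sorted-head≤ [-]         = []
sorted-head≤ (x≤y ∷ y∷s↗) = Linked.Linked⇒All ≤-trans x≤y y∷s↗

sorted-count≤-∷ : ∀ {T x s} → Sorted (x ∷ s) → 0 < count≤ T (x ∷ s) →
                  x ≤ T × count≤ T (x ∷ s) ≡ suc (count≤ T s)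
sorted-count≤-∷ {T} {x} {s} s↗ 0<count with x ≤? T
... | yes x≤T = x≤T , count≤-accept s x≤T
... | no x≰T  = contradiction (subst (0 <_) (count≤-none above) 0<count) n≮0
  where
  above : All (T <_) (x ∷ s)
  above = All.map (<-≤-trans (≰⇒> x≰T)) (≤-refl ∷ sorted-head≤ s↗)

module _ (g : ℕ → ℕ) where

  sorted-below⇒count : ∀ n {s} → Sorted s → All (λ p → proj₂ p ≤ g (proj₁ p)) (indexedFrom n s) →
                       ∀ j → j < length s → j < count≤ (g (n + j)) s
  sorted-below⇒count n {x ∷ s} s↗ (x≤ ∷ _) zero _ =
    subst (λ i → 0 < count≤ (g i) (x ∷ s)) (sym (+-identityʳ n))
      (subst (0 <_) (sym (count≤-accept s x≤)) (s≤s z≤n))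
  sorted-below⇒count n {x ∷ s} s↗ (_ ∷ below) (suc j) (s≤s j<)
    with ih ← subst (λ i → j < count≤ (g i) s) (sym (+-suc n j))
                (sorted-below⇒count (suc n) (Linked.tail s↗) below j j<)
       | x ≤? g (n + suc j)
  ... | yes x≤T = subst (suc j <_) (sym (count≤-accept s x≤T)) (s≤s ih)
  ... | no x≰T  =
    contradiction (subst (j <_) (count≤-none (All.map (<-≤-trans (≰⇒> x≰T)) (sorted-head≤ s↗))) ih) n≮0

  count⇒sorted-below : ∀ n {s} → Sorted s → (∀ j → j < length s → j < count≤ (g (n + j)) s) →
                       All (λ p → proj₂ p ≤ g (proj₁ p)) (indexedFrom n s)
  count⇒sorted-below n {[]}    _  _     = []
  count⇒sorted-below n {x ∷ s} s↗ count =
    proj₁ (sorted-count≤-∷ s↗ (subst (λ i → 0 < count≤ (g i) (x ∷ s)) (+-identityʳ n) (count 0 (s≤s z≤n))))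
    ∷ count⇒sorted-below (suc n) (Linked.tail s↗) count′
    where
    count′ : ∀ j → j < length s → j < count≤ (g (suc n + j)) s
    count′ j j<
      with counted ← subst (λ i → suc j < count≤ (g i) (x ∷ s)) (+-suc n j) (count (suc j) (s≤s j<))
      = ≤-pred (subst (suc j <_) (proj₂ (sorted-count≤-∷ s↗ (<-trans (s≤s z≤n) counted))) counted)

-- The words enumerated by lists

range1≡applyUpTo : ∀ B → range1 B ≡ applyUpTo suc B
range1≡applyUpTo zero    = refl
range1≡applyUpTo (suc B) = trans (cong (_++ suc B ∷ []) (range1≡applyUpTo B)) (applyUpTo-∷ʳ suc B)

∈-range1⁺ : ∀ {B x} → 1 ≤ x → x ≤ B → x ∈ range1 B
∈-range1⁺ {B} {suc x} _ x<B = subst (suc x ∈_) (sym (range1≡applyUpTo B)) (∈-applyUpTo⁺ suc x<B)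

range1-unique : ∀ B → Unique (range1 B)
range1-unique B =
  subst Unique (sym (range1≡applyUpTo B)) (Unique.applyUpTo⁺₁ suc B (λ i<j _ → <⇒≢ (s≤s i<j)))

lists≡cartesianProduct : ∀ B k → lists B (suc k) ≡ cartesianProductWith _∷_ (range1 B) (lists B k)
lists≡cartesianProduct B k = concatMap-map≡cartesianProductWith _∷_ (range1 B) (lists B k)

lists-unique : ∀ B k → Unique (lists B k)
lists-unique B zero    = [] ∷ []
lists-unique B (suc k) = subst Unique (sym (lists≡cartesianProduct B k))
  (Unique.cartesianProductWith⁺ _∷_ ∷-injective (range1-unique B) (lists-unique B k))

∈-lists⁻ : ∀ B k {l} → l ∈ lists B k → length l ≡ k
∈-lists⁻ B zero    (here refl) = refl
∈-lists⁻ B (suc k) l∈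
  with _ , l′ , _ , l′∈ , refl ← ∈-cartesianProductWith⁻ _∷_ (range1 B) (lists B k)
                                   (subst (_ ∈_) (lists≡cartesianProduct B k) l∈)
  = cong suc (∈-lists⁻ B k l′∈)

∈-lists⁺ : ∀ B {l} → All (_∈ range1 B) l → l ∈ lists B (length l)
∈-lists⁺ B []                  = here refl
∈-lists⁺ B {x ∷ l} (x∈ ∷ l∈) =
  subst (_ ∈_) (sym (lists≡cartesianProduct B (length l))) (∈-cartesianProductWith⁺ _∷_ x∈ (∈-lists⁺ B l∈))

-- Binomial coefficients and the ballot recurrence

-- n C⁻ k is n C (k − 1), except that n C⁻ 0 is 0 rather than n C 0.
_C⁻_ : ℕ → ℕ → ℕ
n C⁻ zero  = 0
n C⁻ suc k = n C k

pascal : ∀ n k → suc n C suc k ≡ n C k + n C suc k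
pascal n k = sym (nCk+nC[k+1]≡[n+1]C[k+1] n k)

pascal⁻ : ∀ n k → suc n C k ≡ n C⁻ k + n C k
pascal⁻ n zero    = refl
pascal⁻ n (suc k) = pascal n k

[1+k]*nC[1+k]+k*nCk≡n*nCk : ∀ n k → suc k * (n C suc k) + k * (n C k) ≡ n * (n C k)
[1+k]*nC[1+k]+k*nCk≡n*nCk zero    zero    = refl
[1+k]*nC[1+k]+k*nCk≡n*nCk zero    (suc k) = cong₂ _+_ (*-zeroʳ (2 + k)) (*-zeroʳ (suc k))
[1+k]*nC[1+k]+k*nCk≡n*nCk (suc n) zero    = trans (cong (λ x → 1 * x + 0) (nC1≡n (suc n))) (unit n)
  where
  unit : ∀ n → 1 * suc n + 0 ≡ suc n * 1
  unit = solve-∀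
[1+k]*nC[1+k]+k*nCk≡n*nCk (suc n) (suc j) = begin
  suc (suc j) * (suc n C suc (suc j)) + suc j * (suc n C suc j)
    ≡⟨ cong₂ (λ s t → suc (suc j) * s + suc j * t) (pascal n (suc j)) (pascal n j) ⟩
  suc (suc j) * (y + z) + suc j * (x + y)
    ≡⟨ regroup j x y z ⟩
  (suc (suc j) * z + suc j * y) + (suc j * y + j * x) + (x + y)
    ≡⟨ cong₂ (λ s t → s + t + (x + y)) (absorption (suc j)) (absorption j) ⟩
  n * y + n * x + (x + y)
    ≡⟨ collect n x y ⟩
  suc n * (x + y)
    ≡⟨ cong (suc n *_) (pascal n j) ⟨
  suc n * (suc n C suc j) ∎
  where
  open ≡.≡-Reasoning
  x y z : ℕ
  x = n C j
  y = n C suc j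
  z = n C suc (suc j)
  absorption : ∀ k → suc k * (n C suc k) + k * (n C k) ≡ n * (n C k)
  absorption = [1+k]*nC[1+k]+k*nCk≡n*nCk n
  regroup : ∀ j a b c → suc (suc j) * (b + c) + suc j * (a + b) ≡
                        (suc (suc j) * c + suc j * b) + (suc j * b + j * a) + (a + b)
  regroup = solve-∀
  collect : ∀ n a b → n * b + n * a + (a + b) ≡ suc n * (a + b)
  collect = solve-∀

module BallotRecurrence (m : ℕ) (L : ℕ → ℕ → ℕ)
  (L-zero : ∀ p → L 0 p ≡ 1)
  (L-edge : ∀ k → L (suc k) 0 ≡ L k m)
  (L-step : ∀ k p → L (suc k) (suc p) ≡ L (suc k) p + L k (suc p + m)) where

  open ≡.≡-Reasoning

  m*nCk≡nC[1+k] : ∀ k → m * ((m + suc m * k) C k) ≡ (m + suc m * k) C suc k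
  m*nCk≡nC[1+k] k = sym (*-cancelˡ-≡ _ _ (suc k) (+-cancelʳ-≡ (k * Y) _ _ (begin
    suc k * (n C suc k) + k * Y   ≡⟨ [1+k]*nC[1+k]+k*nCk≡n*nCk n k ⟩
    n * Y                         ≡⟨ expand m k Y ⟩
    suc k * (m * Y) + k * Y       ∎)))
    where
    n Y : ℕ
    n = m + suc m * k
    Y = n C k
    expand : ∀ m k y → (m + suc m * k) * y ≡ suc k * (m * y) + k * y
    expand = solve-∀

  L+m*C⁻≡C : ∀ k p → L k p + m * ((p + suc m * k) C⁻ k) ≡ (p + suc m * k) C k
  L+m*C⁻≡C zero    p rewrite L-zero p | *-zeroʳ m = refl
  L+m*C⁻≡C (suc k) zero = begin
    L (suc k) 0 + m * (n C k)                 ≡⟨ cong₂ (λ x y → x + m * (y C k)) (L-edge k) n≡1+n₀ ⟩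
    L k m + m * (suc n₀ C k)                  ≡⟨ cong (λ x → L k m + m * x) (pascal⁻ n₀ k) ⟩
    L k m + m * (n₀ C⁻ k + n₀ C k)            ≡⟨ distrib (L k m) m (n₀ C⁻ k) (n₀ C k) ⟩
    (L k m + m * (n₀ C⁻ k)) + m * (n₀ C k)    ≡⟨ cong₂ _+_ (L+m*C⁻≡C k m) (m*nCk≡nC[1+k] k) ⟩
    n₀ C k + n₀ C suc k                       ≡⟨ pascal n₀ k ⟨
    suc n₀ C suc k                            ≡⟨ cong (_C suc k) n≡1+n₀ ⟨
    n C suc k                                 ∎
    where
    n n₀ : ℕ
    n  = suc m * suc k
    n₀ = m + suc m * k
    shape : ∀ m k → suc m * suc k ≡ suc (m + suc m * k)
    shape = solve-∀
    n≡1+n₀ : n ≡ suc n₀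
    n≡1+n₀ = shape m k
    distrib : ∀ l m a b → l + m * (a + b) ≡ (l + m * a) + m * b
    distrib = solve-∀
  L+m*C⁻≡C (suc k) (suc p) = begin
    L (suc k) (suc p) + m * (suc n C k)
      ≡⟨ cong₂ (λ x y → x + m * y) (L-step k p) (pascal⁻ n k) ⟩
    (L (suc k) p + L k (suc p + m)) + m * (n C⁻ k + n C k)
      ≡⟨ regroup (L (suc k) p) (L k (suc p + m)) m (n C⁻ k) (n C k) ⟩
    (L (suc k) p + m * (n C k)) + (L k (suc p + m) + m * (n C⁻ k))
      ≡⟨ cong₂ _+_ (L+m*C⁻≡C (suc k) p) (subst (λ t → L k (suc p + m) + m * (t C⁻ k) ≡ t C k) (shape p m k)
                                                (L+m*C⁻≡C k (suc p + m))) ⟩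
    n C suc k + n C k
      ≡⟨ +-comm (n C suc k) (n C k) ⟩
    n C k + n C suc k
      ≡⟨ pascal n k ⟨
    suc n C suc k ∎
    where
    n : ℕ
    n = p + suc m * suc k
    shape : ∀ p m k → suc p + m + suc m * k ≡ p + suc m * suc k
    shape = solve-∀
    regroup : ∀ l₁ l₂ m a b → (l₁ + l₂) + m * (a + b) ≡ (l₁ + m * b) + (l₂ + m * a)
    regroup = solve-∀

  closedForm : ∀ k → (m * k + 1) * L k 0 ≡ (suc m * k) C k
  closedForm zero    rewrite L-zero 0 | *-zeroʳ m = refl
  closedForm (suc k) = +-cancelʳ-≡ (m * (K * Z)) _ _ (begin
    (m * K + 1) * L K 0 + m * (K * Z)          ≡⟨ cong (λ t → (m * K + 1) * L K 0 + m * t) K*Z≡[mK+1]*Y ⟩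
    (m * K + 1) * L K 0 + m * ((m * K + 1) * Y) ≡⟨ factor (m * K + 1) (L K 0) Y m ⟩
    (m * K + 1) * (L K 0 + m * Y)              ≡⟨ cong ((m * K + 1) *_) (L+m*C⁻≡C K 0) ⟩
    (m * K + 1) * Z                            ≡⟨ expand m K Z ⟩
    Z + m * (K * Z)                            ∎)
    where
    K Y Z : ℕ
    K = suc k
    Y = (suc m * K) C k
    Z = (suc m * K) C K
    K*Z≡[mK+1]*Y : K * Z ≡ (m * K + 1) * Y
    K*Z≡[mK+1]*Y =
      +-cancelʳ-≡ (k * Y) _ _ (trans ([1+k]*nC[1+k]+k*nCk≡n*nCk (suc m * K) k) (split m k Y))
      where
      split : ∀ m k y → suc m * suc k * y ≡ (m * suc k + 1) * y + k * y
      split = solve-∀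
    factor : ∀ a l y m → a * l + m * (a * y) ≡ a * (l + m * y)
    factor = solve-∀
    expand : ∀ m k z → (m * k + 1) * z ≡ z + m * (k * z)
    expand = solve-∀

private
  threshold-delete : ∀ c P j → suc P + (suc c + c) + suc c * j ≡ c + (suc P + suc c * suc j)
  threshold-delete = solve-∀

  threshold-step : ∀ c P i → suc P + suc c * suc i ≡ c + suc (suc P + suc c * i)
  threshold-step = solve-∀

-- d = 1 + c is the parameter of the statement, so the adjacency condition reads aᵢ ≤ aᵢ₊₁ + c.
module ParkingLists (c : ℕ) where

  d m : ℕ
  d = suc c
  m = d + c

  Gap : ℕ → ℕ → Set
  Gap x y = x ≤ y + c

  adjacency≡gap : ∀ y → y + d ∸ 1 ≡ y + c
  adjacency≡gap y = cong (_∸ 1) (+-suc y c)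

  adjacent⇒linked : ∀ {l} → Adjacent d l → Linked Gap l
  adjacent⇒linked adj-[]                = []
  adjacent⇒linked (adj-[-] _)           = [-]
  adjacent⇒linked (adj-∷ x y _ x≤ adj) = subst (x ≤_) (adjacency≡gap y) x≤ ∷ adjacent⇒linked adj

  linked⇒adjacent : ∀ {l} → Linked Gap l → Adjacent d l
  linked⇒adjacent []                           = adj-[]
  linked⇒adjacent [-]                          = adj-[-] _
  linked⇒adjacent (_∷_ {x = x} {y = y} x≤ rest) =
    adj-∷ x y _ (subst (x ≤_) (sym (adjacency≡gap y)) x≤) (linked⇒adjacent rest)

  Parking : ℕ → List ℕ → Set
  Parking P l = ∀ j → j < length l → j < count≤ (P + d * j) l

  AdjParking : ℕ → List ℕ → Set
  AdjParking P l = All (1 ≤_) l × Parking P l × Linked Gap l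

  Parking-↭ : ∀ {P xs ys} → xs ↭ ys → Parking P xs → Parking P ys
  Parking-↭ xs↭ys park j j< = subst (j <_) (count≤-↭ xs↭ys) (park j (subst (j <_) (sym (↭-length xs↭ys)) j<))

  Parking-bounded : ∀ {P l} → Parking P l → All (_≤ P + d * length l) l
  Parking-bounded {P} {[]}    _    = []
  Parking-bounded {P} {x ∷ l} park = All.map (λ x≤ → ≤-trans x≤ lastThreshold≤) (count≤-complete (park (length l) ≤-refl))
    where
    lastThreshold≤ : P + d * length l ≤ P + d * suc (length l)
    lastThreshold≤ = +-monoʳ-≤ P (*-monoʳ-≤ d (n≤1+n (length l)))

  isParking⇔parking : ∀ {as} → IsParking d as ⇔ (All (1 ≤_) as × Parking 1 as)
  isParking⇔parking {as} = mk⇔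
    (λ (pos , below) → pos , Parking-↭ {1} (sort-↭ as) (λ j j< →
      subst (λ T → j < count≤ T (sort as)) (+-comm (d * j) 1) (sorted-below⇒count g 1 (sort-↗ as) below j j<)))
    (λ (pos , park) → pos , count⇒sorted-below g 1 (sort-↗ as) (λ j j< →
      subst (λ T → j < count≤ T (sort as)) (+-comm 1 (d * j)) (Parking-↭ {1} (↭-sym (sort-↭ as)) park j j<)))
    where
    g : ℕ → ℕ
    g i = d * (i ∸ 1) + 1

  gap-shift : ∀ k {x y} → Gap (k + x) (k + y) ⇔ Gap x y
  gap-shift k {x} {y} = mk⇔
    (λ le → +-cancelˡ-≤ k x (y + c) (subst (k + x ≤_) (+-assoc k y c) le))
    (λ le → subst (k + x ≤_) (sym (+-assoc k y c)) (+-monoʳ-≤ k le))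

  linked-shift : ∀ k {l} → Linked Gap (map (k +_) l) ⇔ Linked Gap l
  linked-shift k = mk⇔
    (Linked.map (Equivalence.to (gap-shift k)) ∘ Linked.map⁻)
    (Linked.map⁺ ∘ Linked.map (Equivalence.from (gap-shift k)))

  parking-shift : ∀ P l → Parking (suc P) (map suc l) ⇔ Parking P l
  parking-shift P l = mk⇔
    (λ park j j< → subst (j <_) (count≤-shift 1 (P + d * j) l) (park j (subst (j <_) (sym (length-map suc l)) j<)))
    (λ park j j< → subst (j <_) (sym (count≤-shift 1 (P + d * j) l)) (park j (subst (j <_) (length-map suc l) j<)))

  adjParking-shift⁺ : ∀ P {l} → AdjParking P l → AdjParking (suc P) (map suc l)
  adjParking-shift⁺ P {l} (_ , park , linked) =
    All.map⁺ (All.universal (λ _ → s≤s z≤n) l) ,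
    Equivalence.from (parking-shift P l) park ,
    Equivalence.from (linked-shift 1) linked

  adjParking-shift⁻ : ∀ P {l} → All (1 ≤_) l → AdjParking (suc P) (map suc l) → AdjParking P l
  adjParking-shift⁻ P {l} pos (_ , park , linked) =
    pos , Equivalence.to (parking-shift P l) park , Equivalence.to (linked-shift 1) linked

  length-delete : ∀ u v → length (u ++ 1 ∷ v) ≡ suc (length (u ++ map (c +_) v))
  length-delete u v = begin
    length (u ++ 1 ∷ v)                ≡⟨ length-++ u ⟩
    length u + suc (length v)          ≡⟨ +-suc (length u) (length v) ⟩
    suc (length u + length v)          ≡⟨ cong (λ n → suc (length u + n)) (length-map (c +_) v) ⟨
    suc (length u + length (map (c +_) v)) ≡⟨ cong suc (length-++ u) ⟨
    suc (length (u ++ map (c +_) v))   ∎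
    where open ≡.≡-Reasoning

  count≤-withOne : ∀ {X} u v → 1 ≤ X → count≤ X (u ++ 1 ∷ v) ≡ suc (count≤ X u + count≤ X v)
  count≤-withOne u v 1≤X =
    trans (count≤-++ u (1 ∷ v)) (trans (cong (count≤ _ u +_) (count≤-accept v 1≤X)) (+-suc _ _))

  count≤-raised : ∀ X u v → count≤ (c + X) (u ++ map (c +_) v) ≡ count≤ (c + X) u + count≤ X v
  count≤-raised X u v = trans (count≤-++ u (map (c +_) v)) (cong (count≤ (c + X) u +_) (count≤-shift c X v))

  parking-delete : ∀ P u v → Parking (suc P) (u ++ 1 ∷ v) → Parking (suc P + m) (u ++ map (c +_) v)
  parking-delete P u v park j j< =
    subst (λ T → j < count≤ T (u ++ map (c +_) v)) (sym (threshold-delete c P j)) (begin-strict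
      j                                    <⟨ ≤-pred (subst (suc j <_) (count≤-withOne u v (s≤s z≤n)) (park (suc j) suc-j<)) ⟩
      count≤ X u + count≤ X v              ≤⟨ +-monoˡ-≤ (count≤ X v) (count≤-mono (m≤n+m X c) u) ⟩
      count≤ (c + X) u + count≤ X v        ≡⟨ count≤-raised X u v ⟨
      count≤ (c + X) (u ++ map (c +_) v)   ∎)
    where
    open ≤-Reasoning
    X : ℕ
    X = suc P + d * suc j
    suc-j< : suc j < length (u ++ 1 ∷ v)
    suc-j< = subst (suc j <_) (sym (length-delete u v)) (s≤s j<)

  gapLinked-crossing : ∀ {X x l} → Linked Gap (x ∷ l) → X < x → Any (_≤ X) l →
                       Any (λ w → w ≤ X × Gap X w) l
  gapLinked-crossing {X} {x} {y ∷ l} (x≤ ∷ linked) X<x y∷l≤X with y ≤? X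
  ... | yes y≤X = here (y≤X , <⇒≤ (<-≤-trans X<x x≤))
  ... | no y≰X  = there (gapLinked-crossing linked (≰⇒> y≰X) (Any.tail y≰X y∷l≤X))

  gapLinked-crossing-++ : ∀ {X} u {r} → Linked Gap (u ++ r) → Any (X <_) u → Any (_≤ X) r →
                          Any (λ w → w ≤ X × Gap X w) (u ++ r)
  gapLinked-crossing-++ (x ∷ u) linked (here X<x)  r≤X =
    there (gapLinked-crossing linked X<x (Any.++⁺ʳ u r≤X))
  gapLinked-crossing-++ (x ∷ u) linked (there u>X) r≤X =
    there (gapLinked-crossing-++ u (Linked.tail linked) u>X r≤X)

  -- If some entry of u exceeds X, the walk from it down to the inserted 1 meets the window
  -- (Y, X] = (X − d, X], so the count below X exceeds the one below Y.
  parking-insert : ∀ P u v → Linked Gap (u ++ 1 ∷ v) → Parking (suc P + m) (u ++ map (c +_) v) →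
                   Parking (suc P) (u ++ 1 ∷ v)
  parking-insert P u v linked park = go
    where
    go : Parking (suc P) (u ++ 1 ∷ v)
    go zero    _ = subst (0 <_) (sym (count≤-withOne u v (s≤s z≤n))) (s≤s z≤n)
    go (suc i) suc-i< = step (all? (_≤? X) u)
      where
      X Y : ℕ
      X = suc P + d * suc i
      Y = suc P + d * i
      X≡c+1+Y : X ≡ c + suc Y
      X≡c+1+Y = threshold-step c P i
      ih : i < count≤ Y (u ++ 1 ∷ v)
      ih = go i (<-trans (n<1+n i) suc-i<)
      fromRaised : i < count≤ (c + X) u + count≤ X v
      fromRaised = subst (i <_) (count≤-raised X u v)
        (subst (λ T → i < count≤ T (u ++ map (c +_) v)) (threshold-delete c P i)
          (park i (≤-pred (subst (suc i <_) (length-delete u v) suc-i<))))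
      conclude : i < count≤ X u + count≤ X v → suc i < count≤ X (u ++ 1 ∷ v)
      conclude i< = subst (suc i <_) (sym (count≤-withOne u v (s≤s z≤n))) (s≤s i<)
      above⇒window : ∀ {w} → w ≤ X × Gap X w → Y < w × w ≤ X
      above⇒window {w} (w≤X , X≤w+c) =
        +-cancelˡ-≤ c (suc Y) w (subst₂ _≤_ X≡c+1+Y (+-comm w c) X≤w+c) , w≤X
      step : Dec (All (_≤ X) u) → suc i < count≤ X (u ++ 1 ∷ v)
      step (yes u≤X) = conclude (subst (λ n → i < n + count≤ X v) raised≡ fromRaised)
        where
        raised≡ : count≤ (c + X) u ≡ count≤ X u
        raised≡ =
          trans (count≤-all (All.map (λ x≤ → ≤-trans x≤ (m≤n+m X c)) u≤X)) (sym (count≤-all u≤X))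
      step (no u≰X) = <-≤-trans (s≤s ih) (count≤-strictMono Y≤X (Any.map above⇒window crossing))
        where
        Y≤X : Y ≤ X
        Y≤X = subst (Y ≤_) (sym X≡c+1+Y) (≤-trans (n≤1+n Y) (m≤n+m (suc Y) c))
        crossing : Any (λ w → w ≤ X × Gap X w) (u ++ 1 ∷ v)
        crossing =
          gapLinked-crossing-++ u linked (Any.map ≰⇒> (All.¬All⇒Any¬ (_≤? X) u u≰X)) (here (s≤s z≤n))

  d≤[c+y]+c : ∀ {y} → 1 ≤ y → d ≤ (c + y) + c
  d≤[c+y]+c {y} 1≤y = ≤-trans (subst (_≤ c + y) (+-comm c 1) (+-monoʳ-≤ c 1≤y)) (m≤m+n (c + y) c)

  linked-one∷ : ∀ {v} → All (1 ≤_) v → Linked Gap v → Linked Gap (1 ∷ v)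
  linked-one∷ []          []     = [-]
  linked-one∷ (1≤y ∷ _) linked = ≤-trans 1≤y (m≤m+n _ c) ∷ linked

  linked-delete : ∀ u {v} → All (1 ≤_) v → Linked Gap (u ++ 1 ∷ v) →
                  Linked Gap (u ++ map (c +_) v) × Maybe.All (_≤ d) (last u)
  linked-delete []                   _         linked         =
    Equivalence.from (linked-shift c) (Linked.tail linked) , nothing
  linked-delete (x ∷ [])     {[]}    _         (x≤d ∷ _)      = [-] , just x≤d
  linked-delete (x ∷ [])     {y ∷ v} (1≤y ∷ _) (x≤d ∷ linked) =
    ≤-trans x≤d (d≤[c+y]+c 1≤y) ∷ Equivalence.from (linked-shift c) (Linked.tail linked) , just x≤d
  linked-delete (x ∷ x′ ∷ u)         v≥1       (x≤ ∷ linked)  =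
    let linked′ , last≤ = linked-delete (x′ ∷ u) v≥1 linked in x≤ ∷ linked′ , last≤

  linked-insert : ∀ u {v} → All (1 ≤_) v → Maybe.All (_≤ d) (last u) →
                  Linked Gap (u ++ map (c +_) v) → Linked Gap (u ++ 1 ∷ v)
  linked-insert []           v≥1 _          linked        =
    linked-one∷ v≥1 (Equivalence.to (linked-shift c) linked)
  linked-insert (x ∷ [])     v≥1 (just x≤d) linked        = x≤d ∷ linked-insert [] v≥1 nothing (Linked.tail linked)
  linked-insert (x ∷ x′ ∷ u) v≥1 last≤      (x≤ ∷ linked) = x≤ ∷ linked-insert (x′ ∷ u) v≥1 last≤ linked

  adjParking-delete : ∀ P u v → AdjParking (suc P) (u ++ 1 ∷ v) →
                      AdjParking (suc P + m) (u ++ map (c +_) v) × Maybe.All (_≤ d) (last u)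
  adjParking-delete P u v (pos , park , linked) =
    let v≥1 = All.tail (All.++⁻ʳ u pos)
        linked′ , last≤ = linked-delete u v≥1 linked
        raised≥1 = All.map⁺ (All.map (λ 1≤y → ≤-trans 1≤y (m≤n+m _ c)) v≥1)
    in (All.++⁺ (All.++⁻ˡ u pos) raised≥1 , parking-delete P u v park , linked′) , last≤

  adjParking-insert : ∀ P u v → All (1 ≤_) v → Maybe.All (_≤ d) (last u) →
                      AdjParking (suc P + m) (u ++ map (c +_) v) → AdjParking (suc P) (u ++ 1 ∷ v)
  adjParking-insert P u v v≥1 last≤ (pos , park , linked) =
    let linked′ = linked-insert u v≥1 last≤ linked
    in All.++⁺ (All.++⁻ˡ u pos) (s≤s z≤n ∷ v≥1) , parking-insert P u v linked′ park , linked′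

  -- Undoes deleting the last 1 and raising the entries after it by c: the raised entries are
  -- recovered as the longest suffix of entries above d.
  insertOne : List ℕ → List ℕ
  insertOne []       = 1 ∷ []
  insertOne (x ∷ xs) with all? (d <?_) (x ∷ xs)
  ... | yes _ = 1 ∷ map (_∸ c) (x ∷ xs)
  ... | no _  = x ∷ insertOne xs

  length-insertOne : ∀ b → length (insertOne b) ≡ suc (length b)
  length-insertOne []       = refl
  length-insertOne (x ∷ xs) with all? (d <?_) (x ∷ xs)
  ... | yes _ = cong suc (length-map (_∸ c) (x ∷ xs))
  ... | no _  = cong suc (length-insertOne xs)

  raised-above : ∀ {v} → All (2 ≤_) v → All (d <_) (map (c +_) v)
  raised-above v≥2 = All.map⁺ (All.map (λ {y} 2≤y → subst (_≤ c + y) (+-comm c 2) (+-monoʳ-≤ c 2≤y)) v≥2)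

  last≤-notAbove : ∀ x u {w} → Maybe.All (_≤ d) (last (x ∷ u)) → ¬ All (d <_) (x ∷ u ++ w)
  last≤-notAbove x []      (just x≤d) (d<x ∷ _) = <⇒≱ d<x x≤d
  last≤-notAbove x (y ∷ u) last≤      (_ ∷ above) = last≤-notAbove y u last≤ above

  last-tail : ∀ {P : ℕ → Set} x u → Maybe.All P (last (x ∷ u)) → Maybe.All P (last u)
  last-tail x []      _     = nothing
  last-tail x (y ∷ u) last≤ = last≤

  insertOne-raised : ∀ u {v} → Maybe.All (_≤ d) (last u) → All (2 ≤_) v →
                     insertOne (u ++ map (c +_) v) ≡ u ++ 1 ∷ v
  insertOne-raised []       {[]}    _     _   = refl
  insertOne-raised []       {y ∷ v} _     v≥2 with all? (d <?_) (c + y ∷ map (c +_) v)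
  ... | yes _     =
    cong (1 ∷_) (trans (sym (map-∘ (y ∷ v))) (map-id-local (All.universal (m+n∸m≡n c) (y ∷ v))))
  ... | no ¬above = contradiction (raised-above v≥2) ¬above
  insertOne-raised (x ∷ u) {v} last≤ v≥2 with all? (d <?_) (x ∷ u ++ map (c +_) v)
  ... | yes above = contradiction above (last≤-notAbove x u last≤)
  ... | no _      = cong (x ∷_) (insertOne-raised u (last-tail x u last≤) v≥2)

  split-raised : ∀ b → ∃₂ λ u v → b ≡ u ++ map (c +_) v × Maybe.All (_≤ d) (last u) × All (2 ≤_) v
  split-raised []      = [] , [] , refl , nothing , []
  split-raised (x ∷ b) with split-raised b
  ... | y ∷ u , v , refl , last≤ , v≥2 = x ∷ y ∷ u , v , refl , last≤ , v≥2
  ... | []    , v , refl , _     , v≥2 with d <? x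
  ...   | no d≮x  = x ∷ [] , v , refl , just (≮⇒≥ d≮x) , v≥2
  ...   | yes d<x =
    [] , x ∸ c ∷ v , cong (_∷ map (c +_) v) (sym (m+[n∸m]≡n c≤x)) , nothing , 2≤x∸c ∷ v≥2
    where
    c≤x : c ≤ x
    c≤x = ≤-trans (n≤1+n c) (<⇒≤ d<x)
    2≤x∸c : 2 ≤ x ∸ c
    2≤x∸c = subst (_≤ x ∸ c) (m+n∸n≡m 2 c) (∸-monoˡ-≤ c d<x)

  1∉-All≥2 : ∀ {v} → All (2 ≤_) v → 1 ∉ v
  1∉-All≥2 v≥2 1∈v = <-irrefl refl (All.lookup v≥2 1∈v)

  1∈insertOne : ∀ b → 1 ∈ insertOne b
  1∈insertOne b with u , v , refl , last≤ , v≥2 ← split-raised b =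
    subst (1 ∈_) (sym (insertOne-raised u last≤ v≥2)) (∈-++⁺ʳ u (here refl))

  insertOne-injective : ∀ {b₁ b₂} → insertOne b₁ ≡ insertOne b₂ → b₁ ≡ b₂
  insertOne-injective {b₁} {b₂} eq
    with u₁ , v₁ , refl , last≤₁ , v₁≥2 ← split-raised b₁
       | u₂ , v₂ , refl , last≤₂ , v₂≥2 ← split-raised b₂
    with refl , refl ← ++-∷-cancel u₁ u₂ (1∉-All≥2 v₁≥2) (1∉-All≥2 v₂≥2)
           (trans (sym (insertOne-raised u₁ last≤₁ v₁≥2)) (trans eq (insertOne-raised u₂ last≤₂ v₂≥2)))
    = refl

  data LastOneView : List ℕ → Set where
    noOne   : ∀ l → All (1 ≤_) l → LastOneView (map suc l)
    lastOne : ∀ u v → All (2 ≤_) v → LastOneView (u ++ 1 ∷ v)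

  lastOneView : ∀ {l} → All (1 ≤_) l → LastOneView l
  lastOneView {[]}        []        = noOne [] []
  lastOneView {suc x ∷ l} (_ ∷ pos) with lastOneView pos
  ... | lastOne u v v≥2 = lastOne (suc x ∷ u) v v≥2
  lastOneView {1 ∷ _}           _ | noOne l₀ pos₀ = lastOne [] (map suc l₀) (All.map⁺ (All.map s≤s pos₀))
  lastOneView {suc (suc x) ∷ _} _ | noOne l₀ pos₀ = noOne (suc x ∷ l₀) (s≤s z≤n ∷ pos₀)

  adjParkings : ℕ → ℕ → List (List ℕ)
  adjParkings zero    p       = [] ∷ []
  adjParkings (suc k) zero    = []
  adjParkings (suc k) (suc p) =
    map (map suc) (adjParkings (suc k) p) ++ map insertOne (adjParkings k (suc p + m))

  adjParking-insertOne : ∀ p {b} → AdjParking (suc p + m) b → AdjParking (suc p) (insertOne b)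
  adjParking-insertOne p {b} adjp with u , v , refl , last≤ , v≥2 ← split-raised b =
    subst (AdjParking (suc p)) (sym (insertOne-raised u last≤ v≥2))
      (adjParking-insert p u v (All.map (≤-trans (n≤1+n 1)) v≥2) last≤ adjp)

  adjParkings-sound : ∀ k p → All (λ l → length l ≡ k × AdjParking p l) (adjParkings k p)
  adjParkings-sound zero    p       = (refl , [] , (λ _ ()) , []) ∷ []
  adjParkings-sound (suc k) zero    = []
  adjParkings-sound (suc k) (suc p) = All.++⁺
    (All.map⁺ (All.map (λ {l} (len , adjp) → trans (length-map suc l) len , adjParking-shift⁺ p adjp)
                       (adjParkings-sound (suc k) p)))
    (All.map⁺ (All.map (λ {b} (len , adjp) → trans (length-insertOne b) (cong suc len) , adjParking-insertOne p adjp)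
                       (adjParkings-sound k (suc p + m))))

  ∈-adjParkings⁺ : ∀ k p {l} → length l ≡ k → AdjParking p l → l ∈ adjParkings k p
  ∈-adjParkings⁺ zero    p {[]} _ _ = here refl
  ∈-adjParkings⁺ (suc k) = go
    where
    go : ∀ p {l} → length l ≡ suc k → AdjParking p l → l ∈ adjParkings (suc k) p
    go zero    {x ∷ l} _   (pos , park , _) = contradiction (subst (0 <_) (count≤-none pos) firstParked) n≮0
      where
      firstParked : 0 < count≤ 0 (x ∷ l)
      firstParked = subst (λ T → 0 < count≤ T (x ∷ l)) (*-zeroʳ d) (park 0 (s≤s z≤n))
    go (suc p) len adjp = place (lastOneView (proj₁ adjp)) len adjp
      where
      place : ∀ {l} → LastOneView l → length l ≡ suc k → AdjParking (suc p) l →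
              l ∈ adjParkings (suc k) (suc p)
      place (noOne l₀ pos₀) len adjp =
        ∈-++⁺ˡ (∈-map⁺ (map suc) (go p (trans (sym (length-map suc l₀)) len) (adjParking-shift⁻ p pos₀ adjp)))
      place (lastOne u v v≥2) len adjp with adjp′ , last≤ ← adjParking-delete p u v adjp =
        ∈-++⁺ʳ (map (map suc) (adjParkings (suc k) p))
          (subst (_∈ map insertOne (adjParkings k (suc p + m))) (insertOne-raised u last≤ v≥2)
            (∈-map⁺ insertOne (∈-adjParkings⁺ k (suc p + m) len′ adjp′)))
        where
        len′ : length (u ++ map (c +_) v) ≡ k
        len′ = suc-injective (trans (sym (length-delete u v)) len)

  adjParkings-unique : ∀ k p → Unique (adjParkings k p)
  adjParkings-unique zero    p       = [] ∷ []
  adjParkings-unique (suc k) zero    = []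
  adjParkings-unique (suc k) (suc p) =
    Unique.++⁺ (Unique.map⁺ (map-injective suc-injective) (adjParkings-unique (suc k) p))
               (Unique.map⁺ insertOne-injective (adjParkings-unique k (suc p + m)))
               disjoint
    where
    disjoint : ∀ {l} → ¬ (l ∈ map (map suc) (adjParkings (suc k) p) ×
                          l ∈ map insertOne (adjParkings k (suc p + m)))
    disjoint (l∈shifted , l∈inserted)
      with l₀ , l₀∈ , refl ← ∈-map⁻ (map suc) l∈shifted
         | b , _ , eq ← ∈-map⁻ insertOne l∈inserted
      = 1∉-All≥2 (All.map⁺ (All.map s≤s (proj₁ (proj₂ (All.lookup (adjParkings-sound (suc k) p) l₀∈)))))
                  (subst (1 ∈_) (sym eq) (1∈insertOne b))

  length-adjParkings : ∀ k p → length (adjParkings (suc k) (suc p)) ≡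
                               length (adjParkings (suc k) p) + length (adjParkings k (suc p + m))
  length-adjParkings k p = trans (length-++ (map (map suc) (adjParkings (suc k) p)))
    (cong₂ _+_ (length-map (map suc) (adjParkings (suc k) p)) (length-map insertOne (adjParkings k (suc p + m))))

  countAdj≡length-adjParkings : ∀ k B → d * k + 1 ≤ B → countAdj d k B ≡ length (adjParkings k 1)
  countAdj≡length-adjParkings k B dk+1≤B =
    unique∧set⇒length≡ (Unique.filter⁺ counted? (lists-unique B k)) (adjParkings-unique k 1) (mk⇔ to from)
    where
    counted? : Decidable (λ as → IsParking d as × Adjacent d as)
    counted? as = isParking? d as ×-dec adjacent? d as
    to : ∀ {l} → l ∈ filter counted? (lists B k) → l ∈ adjParkings k 1
    to l∈ with l∈lists , isp , adj ← ∈-filter⁻ counted? l∈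
      with pos , park ← Equivalence.to isParking⇔parking isp
      = ∈-adjParkings⁺ k 1 (∈-lists⁻ B k l∈lists) (pos , park , adjacent⇒linked adj)
    from : ∀ {l} → l ∈ adjParkings k 1 → l ∈ filter counted? (lists B k)
    from {l} l∈ with len , pos , park , linked ← All.lookup (adjParkings-sound k 1) l∈ =
      ∈-filter⁺ counted? (subst (λ n → l ∈ lists B n) len (∈-lists⁺ B l∈range))
        (Equivalence.from isParking⇔parking (pos , park) , linked⇒adjacent linked)
      where
      bound : 1 + d * length l ≤ B
      bound = subst (λ n → 1 + d * n ≤ B) (sym len) (subst (_≤ B) (+-comm (d * k) 1) dk+1≤B)
      l∈range : All (_∈ range1 B) l
      l∈range =
        All.zipWith (λ (1≤x , x≤) → ∈-range1⁺ 1≤x (≤-trans x≤ bound)) (pos , Parking-bounded {1} park)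

private
  2dk≡[1+m]k : ∀ c k → 2 * suc c * k ≡ suc (suc c + c) * k
  2dk≡[1+m]k = solve-∀

corollary7p8 : (d k : ℕ) → 1 ≤ d → (B : ℕ) → d * k + 1 ≤ B →
    (2 * d * k ∸ k + 1) * countAdj d k B ≡ (2 * d * k) C k
corollary7p8 (suc c) k _ B dk+1≤B = begin
  (2 * d * k ∸ k + 1) * countAdj d k B
    ≡⟨ cong₂ (λ a n → (a + 1) * n) 2dk∸k≡mk (countAdj≡length-adjParkings k B dk+1≤B) ⟩
  (m * k + 1) * length (adjParkings k 1)
    ≡⟨ closedForm k ⟩
  (suc m * k) C k
    ≡⟨ cong (_C k) (2dk≡[1+m]k c k) ⟨
  (2 * d * k) C k ∎
  where
  open ≡.≡-Reasoning
  open ParkingLists c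
  open BallotRecurrence m (λ k p → length (adjParkings k (suc p)))
    (λ _ → refl) (λ k → length-map insertOne (adjParkings k (suc m))) (λ k p → length-adjParkings k (suc p))
  2dk∸k≡mk : 2 * d * k ∸ k ≡ m * k
  2dk∸k≡mk = trans (cong (_∸ k) (2dk≡[1+m]k c k)) (m+n∸m≡n k (m * k))
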